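{- Let $(H,v)$ be a rooted graph. Then for any integers $k\ge 0$ and $g\ge 2$, \[ X_{P^k(C_g,\,H)}=(g-1)X_{H^{k+g-1}}-\sum_{l=1}^{g-2}X_{C_{g-l}}\,X_{H^{k+l-1}}. \]
   Context: All graphs are finite; $X_G=\sum_{\kappa}\prod_{v\in V(G)}x_{\kappa(v)}$ over proper colorings $\kappa:V(G)\to\{1,2,\dots\}$ is the chromatic symmetric function. $C_g$ is the cycle on $g$ vertices, rooted at any vertex; $C_2$ is understood as its underlying simple graph $K_2$ (so $X_{C_2}=2e_2$, $e_2$ the second elementary symmetric function). For rooted graphs $(G,u)$, $(H,v)$ and $k\ge 0$, the path-conjoined graph $P^k(G,H)$ is obtained from disjoint copies of $G$ and $H$ by adding a path of length $k$ linking $u$ and $v$ (for $k=0$, $u$ and $v$ are identified). The tailed graph is $H^j=P^j(H,K_1)$, i.e., $H$ with a path of length $j$ attached at its root. -}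

module Defs where

open import Data.Nat using (ℕ; zero; suc; _+_; _∸_; _≤_)
open import Data.Integer using (ℤ; +_; _-_) renaming (_*_ to _*ℤ_; _+_ to _+ℤ_)
open import Data.Fin using (Fin; zero; suc; _↑ˡ_; _↑ʳ_; punchOut; inject₁; fromℕ; _≟_)
open import Data.List using (List; []; _∷_; map; concatMap; allFin; upTo; foldr; length; filter; _++_)
open import Data.Vec using (Vec; []; _∷_; lookup)
open import Data.Product using (_×_; _,_; proj₁; proj₂)
open import Data.Bool using (Bool; true; false; _∧_; not)
open import Data.List.Relation.Unary.All using (All)
open import Relation.Nullary using (yes; no; ¬_)
open import Relation.Nullary.Decidable using (does)
open import Relation.Binary.PropositionalEquality using (_≡_; sym)
import Data.Nat as ℕ

-- Vertex set Fin (suc m), edges given as a list of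
-- (unordered, read symmetrically) pairs, and a root vertex.
-- Repeated edges are harmless (they do not change proper colourings).

record RGraph : Set where
  constructor rg
  field
    m     : ℕ
    edges : List (Fin (suc m) × Fin (suc m))
    root  : Fin (suc m)
open RGraph public

∣V∣ : RGraph → ℕ
∣V∣ G = suc (m G)

Loopless : RGraph → Set
Loopless G = All (λ e → ¬ (proj₁ e ≡ proj₂ e)) (edges G)

K₁ : RGraph
K₁ = rg 0 [] zero

mapE : ∀ {a b} → (Fin a → Fin b) → List (Fin a × Fin a) → List (Fin b × Fin b)
mapE f = map (λ e → f (proj₁ e) , f (proj₂ e))

-- Identify the root u of G with the root v of H (the k = 0 case of P^k).
-- Result is rooted at the identified vertex.
glue : RGraph → RGraph → RGraph
glue (rg a eG u) (rg b eH v) = rg (a + b) (mapE gmap eG ++ mapE hmap eH) (gmap u)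
  where
  gmap : Fin (suc a) → Fin (suc (a + b))
  gmap x = x ↑ˡ b
  hmap : Fin (suc b) → Fin (suc (a + b))
  hmap x with x ≟ v
  ... | yes _ = gmap u
  ... | no ne = suc a ↑ʳ punchOut {i = v} (λ eq → ne (sym eq))

addLeaf : RGraph → RGraph
addLeaf (rg a e r) = rg (suc a) ((zero , suc r) ∷ mapE suc e) zero

tailPath : RGraph → ℕ → RGraph
tailPath H zero    = H
tailPath H (suc j) = addLeaf (tailPath H j)

-- P^k(G,H): disjoint G and H with a path of length k linking their roots
-- (for k = 0 the roots are identified).  (The root of the result is
-- irrelevant for chromatic symmetric functions.)
P : ℕ → RGraph → RGraph → RGraph
P k G H = glue G (tailPath H k)

tailed : RGraph → ℕ → RGraph
tailed H j = P j H K₁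

-- cyc n = the cycle C_{n+2} on vertices 0..n+1, rooted at 0.
-- For n = 0 this is K_2 (the closing edge is omitted, as C_2 := K_2).
cyc : ℕ → RGraph
cyc n = rg (suc n) (pathEdges n ++ closing n) zero
  where
  pathEdges : (n : ℕ) → List (Fin (suc (suc n)) × Fin (suc (suc n)))
  pathEdges n = map (λ i → inject₁ i , suc i) (allFin (suc n))
  closing : (n : ℕ) → List (Fin (suc (suc n)) × Fin (suc (suc n)))
  closing zero    = []
  closing (suc n) = (fromℕ (suc (suc n)) , zero) ∷ []

-- C g = the cycle C_g (meaningful for g ≥ 2; only used there).
C : ℕ → RGraph
C g = cyc (g ∸ 2)

-- Symmetric functions, represented through their restrictions to N
-- variables x_1..x_N: a polynomial in N variables is given by its
-- coefficient function on exponent vectors α : Fin N → ℕ.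

Poly : ℕ → Set
Poly N = (Fin N → ℕ) → ℤ

allVec : (N n : ℕ) → List (Vec (Fin N) n)
allVec N zero    = [] ∷ []
allVec N (suc n) = concatMap (λ c → map (c ∷_) (allVec N n)) (allFin N)

occ : ∀ {N n} → Fin N → Vec (Fin N) n → ℕ
occ i []      = 0
occ i (c ∷ κ) with does (c ≟ i)
... | true  = suc (occ i κ)
... | false = occ i κ

allB : ∀ {A : Set} → (A → Bool) → List A → Bool
allB p []       = true
allB p (x ∷ xs) = p x ∧ allB p xs

proper : ∀ {N} (G : RGraph) → Vec (Fin N) (∣V∣ G) → Bool
proper G κ = allB (λ e → not (does (lookup κ (proj₁ e) ≟ lookup κ (proj₂ e)))) (edges G)

hasType : ∀ {N n} → (Fin N → ℕ) → Vec (Fin N) n → Bool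
hasType {N} α κ = allB (λ i → does (occ i κ ℕ.≟ α i)) (allFin N)

X : RGraph → (N : ℕ) → Poly N
X G N α = + length (filter (λ κ → Data.Bool.T? (proper G κ ∧ hasType α κ)) (allVec N (∣V∣ G)))
  where import Data.Bool

below : ∀ {N} → (Fin N → ℕ) → List (Fin N → ℕ)
below {zero}  α = (λ ()) ∷ []
below {suc N} α = concatMap (λ b → map (λ β → λ { zero → b ; (suc i) → β i }) (below (λ i → α (suc i)))) (upTo (suc (α zero)))

sumℤ : List ℤ → ℤ
sumℤ = foldr _+ℤ_ (+ 0)

_⊕_ : ∀ {N} → Poly N → Poly N → Poly N
(f ⊕ g) α = f α +ℤ g α

_⊖_ : ∀ {N} → Poly N → Poly N → Poly N
(f ⊖ g) α = f α - g α

_·_ : ∀ {N} → ℤ → Poly N → Poly N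
(c · f) α = c *ℤ f α

_⊗_ : ∀ {N} → Poly N → Poly N → Poly N
(f ⊗ g) α = sumℤ (map (λ β → f β *ℤ g (λ i → α i ∸ β i)) (below α))

Σ[_]_ : ∀ {N} {A : Set} → List A → (A → Poly N) → Poly N
(Σ[ xs ] F) α = sumℤ (map (λ x → F x α) xs)

range : ℕ → ℕ → List ℕ
range a b = map (λ i → a + i) (upTo (suc b ∸ a))

-- Fix the coefficient of x^α, so that every chromatic symmetric function becomes a count of proper
-- colourings with that monomial. Each graph in the formula is H^k, coloured from the root of H out to
-- the tip of the tail, with g further vertices a₁ … a_g hanging at the tip, whose colour is c:
-- P^k(C_{g+1}, H) closes the cycle c a₁ … a_g c, the product X_{C_g} X_{H^k} has the separate cycle
-- a₁ … a_g a₁, P^{k+1}(C_g, H) has c ≠ a₁ and that cycle, and H^{k+g} has the path c a₁ … a_g.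
-- For a proper path a₁ … a_g the indicators satisfy
--   [c ≠ a₁, a_g ≠ c] + [a_g ≠ a₁] + [c = a_g] = [c ≠ a₁, a_g ≠ a₁] + [c ≠ a₁] + [c = a₁],
-- and reversing a₁ … a_g keeps the monomial and swaps [c = a_g] with [c = a₁]. Hence
--   X_{P^k(C_{g+1},H)} + X_{C_g} X_{H^k} = X_{P^{k+1}(C_g,H)} + X_{H^{k+g}},
-- and the formula follows by induction on g from P^k(C_2, H) = H^{k+1}.

module Submission where

open import Defs
open import Algebra.Bundles using (CommutativeSemigroup)
import Algebra.Properties.CommutativeSemigroup
open import Data.Bool using (Bool; true; false; _∧_; not; T?)
open import Data.Bool.Properties using (∧-assoc; ∧-comm; ∧-identityʳ)
open import Data.Fin using (Fin; zero; suc; fromℕ; inject₁; _↑ˡ_; _↑ʳ_; punchIn; punchOut)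
import Data.Fin as Fin
open import Data.Fin.Properties using (punchIn-punchOut)
open import Data.Integer using (ℤ; +_) renaming (_*_ to _*ℤ_; _+_ to _+ℤ_; _-_ to _-ℤ_)
import Data.Integer.Properties as ℤ
open import Data.Integer.Tactic.RingSolver using (solve-∀)
open import Data.List using (List; []; _∷_; map; concatMap; allFin; upTo; applyUpTo; length; filter; _++_)
open import Data.List.Properties using (map-tabulate; map-applyUpTo; map-∘; map-cong)
open import Data.Nat using (ℕ; zero; suc; _+_; _*_; _∸_; _≤_; z≤n; s≤s)
import Data.Nat as ℕ
open import Data.Nat.Properties
open import Data.Product using (_×_; _,_; proj₁; proj₂)
open import Data.Vec using (Vec; []; _∷_; lookup; insertAt; head; tail; last; _∷ʳ_; reverse; zipWith; replicate)
  renaming (_++_ to _++ᵥ_; tabulate to tabulateᵥ)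
open import Data.Vec.Properties
  using ( zipWith-assoc; zipWith-comm; zipWith-identityˡ; zipWith-identityʳ; lookup-zipWith; lookup-replicate
        ; lookup-++ˡ; lookup-++ʳ; insertAt-lookup; insertAt-punchIn; lookup∘tabulate; reverse-∷; last-reverse )
open import Function using (_∘_)
open import Level using (0ℓ)
open import Relation.Binary.PropositionalEquality
open import Relation.Binary.PropositionalEquality.Algebra using (isMagma)
open import Relation.Nullary using (yes; no; contradiction)
open import Relation.Nullary.Decidable using (does)
open import Algebra.Properties.CommutativeSemigroup +-commutativeSemigroup using ()
  renaming (interchange to +-interchange)
open import Algebra.Properties.CommutativeSemigroup *-commutativeSemigroup using ()
  renaming (interchange to *-interchange; x∙yz≈y∙xz to *-left-comm)

open ≡-Reasoning

private variable
  A B : Set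
  N n : ℕ

∑ : List A → (A → ℕ) → ℕ
∑ []       f = 0
∑ (x ∷ xs) f = f x + ∑ xs f

syntax ∑ xs (λ x → e) = ∑[ x ∈ xs ] e

∑-cong : ∀ (xs : List A) {f g : A → ℕ} → (∀ x → f x ≡ g x) → ∑ xs f ≡ ∑ xs g
∑-cong []       f≗g = refl
∑-cong (x ∷ xs) f≗g = cong₂ _+_ (f≗g x) (∑-cong xs f≗g)

∑-++ : ∀ (xs ys : List A) f → ∑ (xs ++ ys) f ≡ ∑ xs f + ∑ ys f
∑-++ []       ys f = refl
∑-++ (x ∷ xs) ys f = trans (cong (_+_ (f x)) (∑-++ xs ys f)) (sym (+-assoc (f x) _ _))

∑-zero : ∀ (xs : List A) → ∑[ x ∈ xs ] 0 ≡ 0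
∑-zero []       = refl
∑-zero (x ∷ xs) = ∑-zero xs

∑-+ : ∀ (xs : List A) f g → ∑[ x ∈ xs ] (f x + g x) ≡ ∑ xs f + ∑ xs g
∑-+ []       f g = refl
∑-+ (x ∷ xs) f g = trans (cong (_+_ (f x + g x)) (∑-+ xs f g)) (+-interchange (f x) (g x) _ _)

∑-*ˡ : ∀ (xs : List A) a f → ∑[ x ∈ xs ] (a * f x) ≡ a * ∑ xs f
∑-*ˡ []       a f = sym (*-zeroʳ a)
∑-*ˡ (x ∷ xs) a f = trans (cong (_+_ (a * f x)) (∑-*ˡ xs a f)) (sym (*-distribˡ-+ a (f x) _))

∑-map : ∀ (h : A → B) (xs : List A) f → ∑ (map h xs) f ≡ ∑ xs (f ∘ h)
∑-map h []       f = refl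
∑-map h (x ∷ xs) f = cong (_+_ (f (h x))) (∑-map h xs f)

∑-concatMap : ∀ (h : A → List B) (xs : List A) f → ∑ (concatMap h xs) f ≡ ∑[ x ∈ xs ] ∑ (h x) f
∑-concatMap h []       f = refl
∑-concatMap h (x ∷ xs) f = trans (∑-++ (h x) _ f) (cong (_+_ (∑ (h x) f)) (∑-concatMap h xs f))

∑-swap : ∀ (xs : List A) (ys : List B) (f : A → B → ℕ) →
  ∑[ x ∈ xs ] ∑[ y ∈ ys ] f x y ≡ ∑[ y ∈ ys ] ∑[ x ∈ xs ] f x y
∑-swap []       ys f = sym (∑-zero ys)
∑-swap (x ∷ xs) ys f = trans (cong (_+_ (∑ ys (f x))) (∑-swap xs ys f)) (sym (∑-+ ys (f x) _))

∑-*-∑ : ∀ (xs : List A) (ys : List B) (f : A → ℕ) (g : B → ℕ) →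
  ∑ xs f * ∑ ys g ≡ ∑[ x ∈ xs ] ∑[ y ∈ ys ] (f x * g y)
∑-*-∑ xs ys f g = begin
  ∑ xs f * ∑ ys g                  ≡⟨ *-comm (∑ xs f) _ ⟩
  ∑ ys g * ∑ xs f                  ≡⟨ ∑-*ˡ xs (∑ ys g) f ⟨
  ∑[ x ∈ xs ] (∑ ys g * f x)       ≡⟨ ∑-cong xs (λ x → trans (*-comm _ (f x)) (sym (∑-*ˡ ys (f x) g))) ⟩
  ∑[ x ∈ xs ] ∑[ y ∈ ys ] (f x * g y) ∎

∑-allFin-suc : ∀ n (f : Fin (suc n) → ℕ) → ∑ (allFin (suc n)) f ≡ f zero + ∑[ i ∈ allFin n ] f (suc i)
∑-allFin-suc n f = cong (_+_ (f zero))
  (trans (cong (λ xs → ∑ xs f) (sym (map-tabulate (λ i → i) suc))) (∑-map suc (allFin n) f))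

∑-upTo-suc : ∀ n (f : ℕ → ℕ) → ∑ (upTo (suc n)) f ≡ f 0 + ∑[ i ∈ upTo n ] f (suc i)
∑-upTo-suc n f = cong (_+_ (f 0))
  (trans (cong (λ xs → ∑ xs f) (sym (map-applyUpTo (λ i → i) suc n))) (∑-map suc (upTo n) f))

sumℤ-+ : ∀ (xs : List A) (h : A → ℕ) → sumℤ (map (λ x → + h x) xs) ≡ + ∑ xs h
sumℤ-+ []       h = refl
sumℤ-+ (x ∷ xs) h = trans (cong (+ h x +ℤ_) (sumℤ-+ xs h)) (sym (ℤ.pos-+ (h x) (∑ xs h)))

⟦_⟧ : Bool → ℕ
⟦ true  ⟧ = 1
⟦ false ⟧ = 0

⟦∧⟧ : ∀ a b → ⟦ a ∧ b ⟧ ≡ ⟦ a ⟧ * ⟦ b ⟧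
⟦∧⟧ true  b = sym (+-identityʳ ⟦ b ⟧)
⟦∧⟧ false b = refl

length-filter≡∑ : ∀ (p : A → Bool) (xs : List A) → length (filter (T? ∘ p) xs) ≡ ∑[ x ∈ xs ] ⟦ p x ⟧
length-filter≡∑ p []       = refl
length-filter≡∑ p (x ∷ xs) with p x
... | true  = cong suc (length-filter≡∑ p xs)
... | false = length-filter≡∑ p xs

infix 7 _==ᵇ_ _≠ᵇ_

_==ᵇ_ _≠ᵇ_ : Fin N → Fin N → Bool
x ==ᵇ y = does (x Fin.≟ y)
x ≠ᵇ y = not (x ==ᵇ y)

==ᵇ-sym : ∀ (x y : Fin N) → x ==ᵇ y ≡ y ==ᵇ x
==ᵇ-sym x y with x Fin.≟ y | y Fin.≟ x
... | yes _   | yes _   = refl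
... | no  _   | no  _   = refl
... | yes x≡y | no  y≢x = contradiction (sym x≡y) y≢x
... | no  x≢y | yes y≡x = contradiction (sym y≡x) x≢y

≠ᵇ-sym : ∀ (x y : Fin N) → x ≠ᵇ y ≡ y ≠ᵇ x
≠ᵇ-sym x y = cong not (==ᵇ-sym x y)

∑-δ : ∀ N (c : Fin N) (h : Fin N → ℕ) → ∑[ y ∈ allFin N ] (⟦ y ==ᵇ c ⟧ * h y) ≡ h c
∑-δ (suc N) zero    h = begin
  ∑[ y ∈ allFin (suc N) ] (⟦ y ==ᵇ zero ⟧ * h y)  ≡⟨ ∑-allFin-suc N (λ y → ⟦ y ==ᵇ zero ⟧ * h y) ⟩
  h zero + 0 + ∑[ i ∈ allFin N ] 0              ≡⟨ cong₂ _+_ (+-identityʳ (h zero)) (∑-zero (allFin N)) ⟩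
  h zero + 0                                     ≡⟨ +-identityʳ (h zero) ⟩
  h zero                                         ∎
∑-δ (suc N) (suc c) h = trans (∑-allFin-suc N (λ y → ⟦ y ==ᵇ suc c ⟧ * h y)) (∑-δ N c (h ∘ suc))

insertAt-fromℕ : ∀ (xs : Vec A n) x → insertAt xs (fromℕ n) x ≡ xs ∷ʳ x
insertAt-fromℕ []       x = refl
insertAt-fromℕ (y ∷ xs) x = cong (y ∷_) (insertAt-fromℕ xs x)

module _ {N : ℕ} where

  ∑-allVec-[] : (F : Vec (Fin N) 0 → ℕ) → ∑ (allVec N 0) F ≡ F []
  ∑-allVec-[] F = +-identityʳ (F [])

  ∑-allVec-∷ : ∀ n (F : Vec (Fin N) (suc n) → ℕ) →
    ∑ (allVec N (suc n)) F ≡ ∑[ c ∈ allFin N ] ∑[ κ ∈ allVec N n ] F (c ∷ κ)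
  ∑-allVec-∷ n F = trans (∑-concatMap _ (allFin N) F) (∑-cong (allFin N) (λ c → ∑-map (c ∷_) (allVec N n) F))

  ∑-allVec-++ : ∀ a b (F : Vec (Fin N) (a + b) → ℕ) →
    ∑ (allVec N (a + b)) F ≡ ∑[ κ ∈ allVec N a ] ∑[ κ′ ∈ allVec N b ] F (κ ++ᵥ κ′)
  ∑-allVec-++ zero    b F = sym (∑-allVec-[] (λ κ → ∑[ κ′ ∈ allVec N b ] F (κ ++ᵥ κ′)))
  ∑-allVec-++ (suc a) b F = begin
    ∑ (allVec N (suc a + b)) F
      ≡⟨ ∑-allVec-∷ (a + b) F ⟩
    ∑[ c ∈ allFin N ] ∑[ κ ∈ allVec N (a + b) ] F (c ∷ κ)
      ≡⟨ ∑-cong (allFin N) (λ c → ∑-allVec-++ a b (F ∘ (c ∷_))) ⟩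
    ∑[ c ∈ allFin N ] ∑[ κ ∈ allVec N a ] ∑[ κ′ ∈ allVec N b ] F (c ∷ κ ++ᵥ κ′)
      ≡⟨ ∑-allVec-∷ a _ ⟨
    ∑[ κ ∈ allVec N (suc a) ] ∑[ κ′ ∈ allVec N b ] F (κ ++ᵥ κ′) ∎

  ∑-allVec-insertAt : ∀ n (i : Fin (suc n)) (F : Vec (Fin N) (suc n) → ℕ) →
    ∑ (allVec N (suc n)) F ≡ ∑[ c ∈ allFin N ] ∑[ κ ∈ allVec N n ] F (insertAt κ i c)
  ∑-allVec-insertAt n       zero    F = ∑-allVec-∷ n F
  ∑-allVec-insertAt (suc n) (suc i) F = begin
    ∑ (allVec N (suc (suc n))) F
      ≡⟨ ∑-allVec-∷ (suc n) F ⟩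
    ∑[ x ∈ allFin N ] ∑[ κ ∈ allVec N (suc n) ] F (x ∷ κ)
      ≡⟨ ∑-cong (allFin N) (λ x → ∑-allVec-insertAt n i (F ∘ (x ∷_))) ⟩
    ∑[ x ∈ allFin N ] ∑[ c ∈ allFin N ] ∑[ κ ∈ allVec N n ] F (x ∷ insertAt κ i c)
      ≡⟨ ∑-swap (allFin N) (allFin N) _ ⟩
    ∑[ c ∈ allFin N ] ∑[ x ∈ allFin N ] ∑[ κ ∈ allVec N n ] F (x ∷ insertAt κ i c)
      ≡⟨ ∑-cong (allFin N) (λ c → ∑-allVec-∷ n (λ κ → F (insertAt κ (suc i) c))) ⟨
    ∑[ c ∈ allFin N ] ∑[ κ ∈ allVec N (suc n) ] F (insertAt κ (suc i) c) ∎

  ∑-allVec-∷ʳ : ∀ n (F : Vec (Fin N) (suc n) → ℕ) →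
    ∑ (allVec N (suc n)) F ≡ ∑[ κ ∈ allVec N n ] ∑[ c ∈ allFin N ] F (κ ∷ʳ c)
  ∑-allVec-∷ʳ n F =
    trans (∑-allVec-insertAt n (fromℕ n) F)
   (trans (∑-cong (allFin N) (λ c → ∑-cong (allVec N n) (λ κ → cong F (insertAt-fromℕ κ c))))
          (∑-swap (allFin N) (allVec N n) _))

  ∑-allVec-reverse : ∀ n (F : Vec (Fin N) n → ℕ) → ∑ (allVec N n) (F ∘ reverse) ≡ ∑ (allVec N n) F
  ∑-allVec-reverse zero    F = refl
  ∑-allVec-reverse (suc n) F = begin
    ∑ (allVec N (suc n)) (F ∘ reverse)
      ≡⟨ ∑-allVec-∷ n (F ∘ reverse) ⟩
    ∑[ c ∈ allFin N ] ∑[ κ ∈ allVec N n ] F (reverse (c ∷ κ))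
      ≡⟨ ∑-cong (allFin N) (λ c → ∑-cong (allVec N n) (λ κ → cong F (reverse-∷ c κ))) ⟩
    ∑[ c ∈ allFin N ] ∑[ κ ∈ allVec N n ] F (reverse κ ∷ʳ c)
      ≡⟨ ∑-cong (allFin N) (λ c → ∑-allVec-reverse n (λ κ → F (κ ∷ʳ c))) ⟩
    ∑[ c ∈ allFin N ] ∑[ κ ∈ allVec N n ] F (κ ∷ʳ c)
      ≡⟨ ∑-swap (allFin N) (allVec N n) _ ⟩
    ∑[ κ ∈ allVec N n ] ∑[ c ∈ allFin N ] F (κ ∷ʳ c)
      ≡⟨ ∑-allVec-∷ʳ n F ⟨
    ∑ (allVec N (suc n)) F ∎

-- Contents of colourings: content κ is the exponent vector of the monomial ∏ᵥ x_{κ v}.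

Content : ℕ → Set
Content N = Vec ℕ N

infixl 6 _⊞_

_⊞_ : Content N → Content N → Content N
_⊞_ = zipWith _+_

δ : Fin N → Content N
δ c = tabulateᵥ (λ i → ⟦ c ==ᵇ i ⟧)

content : Vec (Fin N) n → Content N
content []      = replicate _ 0
content (c ∷ κ) = δ c ⊞ content κ

⊞-assoc : ∀ (s t u : Content N) → s ⊞ t ⊞ u ≡ s ⊞ (t ⊞ u)
⊞-assoc = zipWith-assoc +-assoc

⊞-comm : ∀ (s t : Content N) → s ⊞ t ≡ t ⊞ s
⊞-comm = zipWith-comm +-comm

⊞-identityˡ : ∀ (s : Content N) → replicate N 0 ⊞ s ≡ s
⊞-identityˡ = zipWith-identityˡ +-identityˡ

⊞-identityʳ : ∀ (s : Content N) → s ⊞ replicate N 0 ≡ s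
⊞-identityʳ = zipWith-identityʳ +-identityʳ

⊞-commutativeSemigroup : ℕ → CommutativeSemigroup 0ℓ 0ℓ
⊞-commutativeSemigroup N = record
  { isCommutativeSemigroup = record
    { isSemigroup = record { isMagma = isMagma (_⊞_ {N}) ; assoc = ⊞-assoc }
    ; comm        = ⊞-comm
    }
  }

module ⊞ {N : ℕ} = Algebra.Properties.CommutativeSemigroup (⊞-commutativeSemigroup N)

lookup-content : ∀ (κ : Vec (Fin N) n) i → lookup (content κ) i ≡ occ i κ
lookup-content []      i = lookup-replicate i 0
lookup-content (c ∷ κ) i
  rewrite lookup-zipWith _+_ i (δ c) (content κ)
        | lookup∘tabulate (λ j → ⟦ c ==ᵇ j ⟧) i
        | lookup-content κ i
  with does (c Fin.≟ i)
... | true  = refl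
... | false = refl

content-++ : ∀ {a b} (κ : Vec (Fin N) a) (κ′ : Vec (Fin N) b) → content (κ ++ᵥ κ′) ≡ content κ ⊞ content κ′
content-++ []      κ′ = sym (⊞-identityˡ (content κ′))
content-++ (c ∷ κ) κ′ = trans (cong (δ c ⊞_) (content-++ κ κ′)) (sym (⊞-assoc (δ c) _ _))

content-insertAt : ∀ (κ : Vec (Fin N) n) i c → content (insertAt κ i c) ≡ δ c ⊞ content κ
content-insertAt κ       zero    c = refl
content-insertAt (x ∷ κ) (suc i) c =
  trans (cong (δ x ⊞_) (content-insertAt κ i c)) (⊞.x∙yz≈y∙xz (δ x) (δ c) (content κ))

content-∷ʳ : ∀ (κ : Vec (Fin N) n) c → content (κ ∷ʳ c) ≡ content κ ⊞ δ c
content-∷ʳ κ c = begin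
  content (κ ∷ʳ c)                 ≡⟨ cong content (insertAt-fromℕ κ c) ⟨
  content (insertAt κ (fromℕ _) c)  ≡⟨ content-insertAt κ (fromℕ _) c ⟩
  δ c ⊞ content κ                   ≡⟨ ⊞-comm (δ c) (content κ) ⟩
  content κ ⊞ δ c                   ∎

content-reverse : ∀ (κ : Vec (Fin N) n) → content (reverse κ) ≡ content κ
content-reverse []      = refl
content-reverse (c ∷ κ) = begin
  content (reverse (c ∷ κ))  ≡⟨ cong content (reverse-∷ c κ) ⟩
  content (reverse κ ∷ʳ c)   ≡⟨ content-∷ʳ (reverse κ) c ⟩
  content (reverse κ) ⊞ δ c  ≡⟨ cong (_⊞ δ c) (content-reverse κ) ⟩
  content κ ⊞ δ c            ≡⟨ ⊞-comm (content κ) (δ c) ⟩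
  δ c ⊞ content κ            ∎

properPath : Vec (Fin N) n → Bool
properPath []          = true
properPath (x ∷ [])    = true
properPath (x ∷ y ∷ κ) = x ≠ᵇ y ∧ properPath (y ∷ κ)

properCycle : Vec (Fin N) (suc n) → Bool
properCycle κ = properPath κ ∧ last κ ≠ᵇ head κ

properPath-++ : ∀ {a b} x (ρ : Vec (Fin N) a) (κ : Vec (Fin N) b) →
  properPath (x ∷ ρ ++ᵥ κ) ≡ properPath (x ∷ ρ) ∧ properPath (last (x ∷ ρ) ∷ κ)
properPath-++ x []      κ = refl
properPath-++ x (y ∷ ρ) κ = trans (cong (x ≠ᵇ y ∧_) (properPath-++ y ρ κ)) (sym (∧-assoc (x ≠ᵇ y) _ _))

last-++ : ∀ {a b} (x : A) (ρ : Vec A a) (π : Vec A b) → last (x ∷ ρ ++ᵥ π) ≡ last (last (x ∷ ρ) ∷ π)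
last-++ x []      π = refl
last-++ x (y ∷ ρ) π = last-++ y ρ π

properPath-∷ʳ : ∀ (κ : Vec (Fin N) (suc n)) y → properPath (κ ∷ʳ y) ≡ properPath κ ∧ last κ ≠ᵇ y
properPath-∷ʳ (x ∷ [])    y = ∧-identityʳ (x ≠ᵇ y)
properPath-∷ʳ (x ∷ z ∷ κ) y = trans (cong (x ≠ᵇ z ∧_) (properPath-∷ʳ (z ∷ κ) y)) (sym (∧-assoc (x ≠ᵇ z) _ _))

properPath-reverse : ∀ (κ : Vec (Fin N) n) → properPath (reverse κ) ≡ properPath κ
properPath-reverse []          = refl
properPath-reverse (x ∷ [])    = refl
properPath-reverse (x ∷ z ∷ κ) = begin
  properPath (reverse (x ∷ z ∷ κ))
    ≡⟨ cong properPath (reverse-∷ x (z ∷ κ)) ⟩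
  properPath (reverse (z ∷ κ) ∷ʳ x)
    ≡⟨ properPath-∷ʳ (reverse (z ∷ κ)) x ⟩
  properPath (reverse (z ∷ κ)) ∧ last (reverse (z ∷ κ)) ≠ᵇ x
    ≡⟨ cong₂ (λ p y → p ∧ y ≠ᵇ x) (properPath-reverse (z ∷ κ)) (last-reverse (z ∷ κ)) ⟩
  properPath (z ∷ κ) ∧ z ≠ᵇ x
    ≡⟨ cong (properPath (z ∷ κ) ∧_) (≠ᵇ-sym z x) ⟩
  properPath (z ∷ κ) ∧ x ≠ᵇ z
    ≡⟨ ∧-comm (properPath (z ∷ κ)) _ ⟩
  properPath (x ∷ z ∷ κ) ∎

properCycle-K₂ : ∀ (a b : Fin N) → properCycle (a ∷ b ∷ []) ≡ properPath (a ∷ b ∷ [])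
properCycle-K₂ a b = trans (cong ((a ≠ᵇ b ∧ true) ∧_) (≠ᵇ-sym b a)) (idem (a ≠ᵇ b))
  where
  idem : ∀ p → (p ∧ true) ∧ p ≡ p ∧ true
  idem true  = refl
  idem false = refl

-- `proper G κ` unfolds to `respects (edges G) (lookup κ)`.
respects : ∀ {n} → List (Fin n × Fin n) → (Fin n → Fin N) → Bool
respects E ρ = allB (λ e → ρ (proj₁ e) ≠ᵇ ρ (proj₂ e)) E

module _ {N n : ℕ} where

  respects-++ : ∀ (E E′ : List (Fin n × Fin n)) (ρ : Fin n → Fin N) →
    respects (E ++ E′) ρ ≡ respects E ρ ∧ respects E′ ρ
  respects-++ []      E′ ρ = refl
  respects-++ (e ∷ E) E′ ρ =
    trans (cong (_ ∧_) (respects-++ E E′ ρ)) (sym (∧-assoc (ρ (proj₁ e) ≠ᵇ ρ (proj₂ e)) _ _))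

  respects-cong : ∀ (E : List (Fin n × Fin n)) {ρ σ : Fin n → Fin N} →
    (∀ x → ρ x ≡ σ x) → respects E ρ ≡ respects E σ
  respects-cong []      ρ≗σ = refl
  respects-cong (e ∷ E) ρ≗σ =
    cong₂ _∧_ (cong₂ _≠ᵇ_ (ρ≗σ (proj₁ e)) (ρ≗σ (proj₂ e))) (respects-cong E ρ≗σ)

respects-mapE : ∀ {a b} (f : Fin a → Fin b) (E : List (Fin a × Fin a)) (ρ : Fin b → Fin N) →
  respects (mapE f E) ρ ≡ respects E (ρ ∘ f)
respects-mapE f []      ρ = refl
respects-mapE f (e ∷ E) ρ = cong (_ ∧_) (respects-mapE f E ρ)

-- Defs keeps the vertex map of `glue` on its second graph local; a one-edge glue exposes it.
glueʳ : ∀ a (u : Fin (suc a)) b (v : Fin (suc b)) → Fin (suc b) → Fin (suc (a + b))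
glueʳ a u b v x = source (edges (glue (rg a [] u) (rg b ((x , x) ∷ []) v)))
  where
  source : List (Fin (suc (a + b)) × Fin (suc (a + b))) → Fin (suc (a + b))
  source []            = u ↑ˡ b
  source ((y , _) ∷ _) = y

lookup-glueʳ : ∀ a u b v (κ : Vec (Fin N) (suc a)) (κ′ : Vec (Fin N) b) x →
  lookup (κ ++ᵥ κ′) (glueʳ a u b v x) ≡ lookup (insertAt κ′ v (lookup κ u)) x
lookup-glueʳ a u b v κ κ′ x with x Fin.≟ v
... | yes refl = trans (lookup-++ˡ κ κ′ u) (sym (insertAt-lookup κ′ x (lookup κ u)))
... | no  x≢v  = begin
  lookup (κ ++ᵥ κ′) (suc a ↑ʳ punchOut v≢x)   ≡⟨ lookup-++ʳ κ κ′ _ ⟩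
  lookup κ′ (punchOut v≢x)                      ≡⟨ insertAt-punchIn κ′ v _ _ ⟨
  lookup κ″ (punchIn v (punchOut v≢x))          ≡⟨ cong (lookup κ″) (punchIn-punchOut v≢x) ⟩
  lookup κ″ x                                   ∎
  where
  κ″ = insertAt κ′ v (lookup κ u)
  v≢x : v ≢ x
  v≢x = x≢v ∘ sym

proper-glue : ∀ G T (κ : Vec (Fin N) (∣V∣ G)) (κ′ : Vec (Fin N) (m T)) →
  proper (glue G T) (κ ++ᵥ κ′) ≡ proper G κ ∧ proper T (insertAt κ′ (root T) (lookup κ (root G)))
proper-glue G T κ κ′ =
  trans (respects-++ (mapE (_↑ˡ m T) (edges G)) (mapE vertexʳ (edges T)) (lookup (κ ++ᵥ κ′)))
        (cong₂ _∧_
          (trans (respects-mapE (_↑ˡ m T) (edges G) (lookup (κ ++ᵥ κ′)))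
                 (respects-cong (edges G) (lookup-++ˡ κ κ′)))
          (trans (respects-mapE vertexʳ (edges T) (lookup (κ ++ᵥ κ′)))
                 (respects-cong (edges T) (lookup-glueʳ (m G) (root G) (m T) (root T) κ κ′))))
  where vertexʳ = glueʳ (m G) (root G) (m T) (root T)

proper-addLeaf : ∀ T c (κ : Vec (Fin N) (∣V∣ T)) →
  proper (addLeaf T) (c ∷ κ) ≡ c ≠ᵇ lookup κ (root T) ∧ proper T κ
proper-addLeaf T c κ = cong (c ≠ᵇ lookup κ (root T) ∧_) (respects-mapE suc (edges T) (lookup (c ∷ κ)))

-- The path edges of `cyc`, restated because Defs keeps them local.
pathEdges : ∀ n → List (Fin (suc n) × Fin (suc n))
pathEdges n = map (λ i → inject₁ i , suc i) (allFin n)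

pathEdges-suc : ∀ n → pathEdges (suc n) ≡ (zero , suc zero) ∷ mapE suc (pathEdges n)
pathEdges-suc n = cong ((zero , suc zero) ∷_)
  (trans (map-tabulate suc (λ i → inject₁ i , suc i))
         (sym (trans (sym (map-∘ (allFin n))) (map-tabulate (λ i → i) _))))

respects-pathEdges : ∀ n (κ : Vec (Fin N) (suc n)) → respects (pathEdges n) (lookup κ) ≡ properPath κ
respects-pathEdges zero    (x ∷ [])    = refl
respects-pathEdges (suc n) (x ∷ y ∷ κ) =
  trans (cong (λ E → respects E (lookup (x ∷ y ∷ κ))) (pathEdges-suc n))
        (cong (x ≠ᵇ y ∧_) (trans (respects-mapE suc (pathEdges n) (lookup (x ∷ y ∷ κ))) (respects-pathEdges n (y ∷ κ))))

lookup-fromℕ : ∀ (κ : Vec A (suc n)) → lookup κ (fromℕ n) ≡ last κ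
lookup-fromℕ (x ∷ [])    = refl
lookup-fromℕ (x ∷ y ∷ κ) = lookup-fromℕ (y ∷ κ)

proper-cyc : ∀ j (κ : Vec (Fin N) (suc (suc j))) → proper (cyc j) κ ≡ properCycle κ
proper-cyc zero    (a ∷ b ∷ []) = sym (properCycle-K₂ a b)
proper-cyc (suc j) (x ∷ κ)      =
  trans (respects-++ (pathEdges (suc (suc j))) _ (lookup (x ∷ κ)))
        (cong₂ _∧_ (respects-pathEdges _ (x ∷ κ))
                   (trans (∧-identityʳ _) (cong (_≠ᵇ x) (lookup-fromℕ (x ∷ κ)))))

infix 5 _==ℕ_ _≐ᵇ_
infixl 6 _∸ᶠ_

_==ℕ_ : ℕ → ℕ → Bool
x ==ℕ y = does (x ℕ.≟ y)

_≐ᵇ_ : (Fin N → ℕ) → (Fin N → ℕ) → Bool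
_≐ᵇ_ {N} s t = allB (λ i → s i ==ℕ t i) (allFin N)

_∸ᶠ_ : (Fin N → ℕ) → (Fin N → ℕ) → Fin N → ℕ
(α ∸ᶠ β) i = α i ∸ β i

allB-map : ∀ (p : B → Bool) (g : A → B) xs → allB p (map g xs) ≡ allB (p ∘ g) xs
allB-map p g []       = refl
allB-map p g (x ∷ xs) = cong (p (g x) ∧_) (allB-map p g xs)

allB-cong : ∀ (xs : List A) {p q : A → Bool} → (∀ x → p x ≡ q x) → allB p xs ≡ allB q xs
allB-cong []       p≗q = refl
allB-cong (x ∷ xs) p≗q = cong₂ _∧_ (p≗q x) (allB-cong xs p≗q)

≐ᵇ-split : ∀ (u w : Fin (suc N) → ℕ) {x} {w′ : Fin N → ℕ} →
  w zero ≡ x → (∀ i → w (suc i) ≡ w′ i) → u ≐ᵇ w ≡ (u zero ==ℕ x) ∧ ((u ∘ suc) ≐ᵇ w′)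
≐ᵇ-split {N} u w w₀ wₛ = cong₂ (λ x y → (u zero ==ℕ x) ∧ y) w₀
  (trans (cong (allB (λ i → u i ==ℕ w i)) (sym (map-tabulate {n = N} (λ i → i) Fin.suc)))
  (trans (allB-map (λ i → u i ==ℕ w i) suc (allFin N))
         (allB-cong (allFin N) (λ i → cong (u (suc i) ==ℕ_) (wₛ i)))))

∑-upTo-convolution : ∀ a s t → ∑[ b ∈ upTo (suc a) ] (⟦ s ==ℕ b ⟧ * ⟦ t ==ℕ a ∸ b ⟧) ≡ ⟦ s + t ==ℕ a ⟧
∑-upTo-convolution a       zero    t = begin
  ∑[ b ∈ upTo (suc a) ] (⟦ 0 ==ℕ b ⟧ * ⟦ t ==ℕ a ∸ b ⟧)
    ≡⟨ ∑-upTo-suc a (λ b → ⟦ 0 ==ℕ b ⟧ * ⟦ t ==ℕ a ∸ b ⟧) ⟩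
  ⟦ t ==ℕ a ⟧ + 0 + ∑[ b ∈ upTo a ] 0
    ≡⟨ cong₂ _+_ (+-identityʳ _) (∑-zero (upTo a)) ⟩
  ⟦ t ==ℕ a ⟧ + 0
    ≡⟨ +-identityʳ _ ⟩
  ⟦ t ==ℕ a ⟧ ∎
∑-upTo-convolution zero    (suc s) t = refl
∑-upTo-convolution (suc a) (suc s) t =
  trans (∑-upTo-suc (suc a) (λ b → ⟦ suc s ==ℕ b ⟧ * ⟦ t ==ℕ suc a ∸ b ⟧)) (∑-upTo-convolution a s t)

-- `below` builds its exponent vectors with a pattern lambda, abstracted here as `extend`.
∑-below-convolution : ∀ N (α s t : Fin N → ℕ) →
  ∑[ β ∈ below α ] (⟦ s ≐ᵇ β ⟧ * ⟦ t ≐ᵇ α ∸ᶠ β ⟧) ≡ ⟦ (λ i → s i + t i) ≐ᵇ α ⟧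
∑-below-convolution zero    α s t = refl
∑-below-convolution (suc N) α s t = split _ (λ _ _ → refl) (λ _ _ _ → refl)
  where
  α′ s′ t′ : Fin N → ℕ
  α′ = α ∘ suc
  s′ = s ∘ suc
  t′ = t ∘ suc
  F : (Fin (suc N) → ℕ) → ℕ
  F β = ⟦ s ≐ᵇ β ⟧ * ⟦ t ≐ᵇ α ∸ᶠ β ⟧
  D : ℕ → ℕ
  D b = ⟦ s zero ==ℕ b ⟧ * ⟦ t zero ==ℕ α zero ∸ b ⟧
  E : (Fin N → ℕ) → ℕ
  E β = ⟦ s′ ≐ᵇ β ⟧ * ⟦ t′ ≐ᵇ α′ ∸ᶠ β ⟧
  split : (extend : ℕ → (Fin N → ℕ) → Fin (suc N) → ℕ) →
          (∀ b β → extend b β zero ≡ b) → (∀ b β i → extend b β (suc i) ≡ β i) →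
          ∑ (concatMap (λ b → map (extend b) (below α′)) (upTo (suc (α zero)))) F ≡ ⟦ (λ i → s i + t i) ≐ᵇ α ⟧
  split extend ext₀ extₛ = begin
    ∑ (concatMap (λ b → map (extend b) (below α′)) (upTo (suc (α zero)))) F
      ≡⟨ ∑-concatMap (λ b → map (extend b) (below α′)) (upTo (suc (α zero))) F ⟩
    ∑[ b ∈ upTo (suc (α zero)) ] ∑ (map (extend b) (below α′)) F
      ≡⟨ ∑-cong (upTo (suc (α zero))) (λ b →
           trans (∑-map (extend b) (below α′) F) (∑-cong (below α′) (factor b))) ⟩
    ∑[ b ∈ upTo (suc (α zero)) ] ∑[ β ∈ below α′ ] (D b * E β)
      ≡⟨ ∑-*-∑ (upTo (suc (α zero))) (below α′) D E ⟨
    ∑ (upTo (suc (α zero))) D * ∑ (below α′) E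
      ≡⟨ cong₂ _*_ (∑-upTo-convolution (α zero) (s zero) (t zero)) (∑-below-convolution N α′ s′ t′) ⟩
    ⟦ s zero + t zero ==ℕ α zero ⟧ * ⟦ (λ i → s′ i + t′ i) ≐ᵇ α′ ⟧
      ≡⟨ trans (cong ⟦_⟧ (≐ᵇ-split (λ i → s i + t i) α refl (λ _ → refl))) (⟦∧⟧ (s zero + t zero ==ℕ α zero) _) ⟨
    ⟦ (λ i → s i + t i) ≐ᵇ α ⟧ ∎
    where
    factor : ∀ b β → F (extend b β) ≡ D b * E β
    factor b β = begin
      ⟦ s ≐ᵇ extend b β ⟧ * ⟦ t ≐ᵇ α ∸ᶠ extend b β ⟧
        ≡⟨ cong₂ (λ p q → ⟦ p ⟧ * ⟦ q ⟧)
             (≐ᵇ-split s (extend b β) (ext₀ b β) (extₛ b β))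
             (≐ᵇ-split t (α ∸ᶠ extend b β) (cong (α zero ∸_) (ext₀ b β)) (λ i → cong (α′ i ∸_) (extₛ b β i))) ⟩
      ⟦ (s zero ==ℕ b) ∧ (s′ ≐ᵇ β) ⟧ * ⟦ (t zero ==ℕ α zero ∸ b) ∧ (t′ ≐ᵇ α′ ∸ᶠ β) ⟧
        ≡⟨ cong₂ _*_ (⟦∧⟧ (s zero ==ℕ b) (s′ ≐ᵇ β)) (⟦∧⟧ (t zero ==ℕ α zero ∸ b) (t′ ≐ᵇ α′ ∸ᶠ β)) ⟩
      (⟦ s zero ==ℕ b ⟧ * ⟦ s′ ≐ᵇ β ⟧) * (⟦ t zero ==ℕ α zero ∸ b ⟧ * ⟦ t′ ≐ᵇ α′ ∸ᶠ β ⟧)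
        ≡⟨ *-interchange ⟦ s zero ==ℕ b ⟧ ⟦ s′ ≐ᵇ β ⟧ ⟦ t zero ==ℕ α zero ∸ b ⟧ _ ⟩
      D b * E β ∎

Weight : ℕ → Set
Weight N = Content N → ℕ

coeff : (Fin N → ℕ) → Weight N
coeff α s = ⟦ lookup s ≐ᵇ α ⟧

module _ {N : ℕ} where

  χ : RGraph → Weight N → ℕ
  χ G f = ∑[ κ ∈ allVec N (∣V∣ G) ] (⟦ proper G κ ⟧ * f (content κ))

  -- The root is precoloured c and only the other vertices are weighed.
  χᵣ : RGraph → Fin N → Weight N → ℕ
  χᵣ T c g = ∑[ κ ∈ allVec N (m T) ] (⟦ proper T (insertAt κ (root T) c) ⟧ * g (content κ))

  χᵣ-cong : ∀ T c {g h : Weight N} → (∀ s → g s ≡ h s) → χᵣ T c g ≡ χᵣ T c h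
  χᵣ-cong T c g≗h = ∑-cong (allVec N (m T)) (λ κ → cong (⟦ proper T (insertAt κ (root T) c) ⟧ *_) (g≗h (content κ)))

  χ⊗ : RGraph → RGraph → Weight N → ℕ
  χ⊗ A B f = ∑[ κ ∈ allVec N (∣V∣ A) ] (⟦ proper A κ ⟧ * χ B (λ t → f (content κ ⊞ t)))

  X≡χ : ∀ G (α : Fin N → ℕ) → X G N α ≡ + χ G (coeff α)
  X≡χ G α = cong +_ (trans (length-filter≡∑ _ (allVec N (∣V∣ G))) (∑-cong (allVec N (∣V∣ G)) term))
    where
    term : ∀ κ → ⟦ proper G κ ∧ hasType α κ ⟧ ≡ ⟦ proper G κ ⟧ * coeff α (content κ)
    term κ = trans (⟦∧⟧ (proper G κ) _)
      (cong (λ p → ⟦ proper G κ ⟧ * ⟦ p ⟧) (allB-cong (allFin N) (λ i → cong (_==ℕ α i) (sym (lookup-content κ i)))))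

  ⊗≡χ⊗ : ∀ A B (α : Fin N → ℕ) → (X A N ⊗ X B N) α ≡ + χ⊗ A B (coeff α)
  ⊗≡χ⊗ A B α = begin
    sumℤ (map (λ β → X A N β *ℤ X B N (α ∸ᶠ β)) (below α))
      ≡⟨ cong sumℤ (map-cong (λ β → trans (cong₂ _*ℤ_ (X≡χ A β) (X≡χ B (α ∸ᶠ β)))
                                         (sym (ℤ.pos-* (χ A (coeff β)) (χ B (coeff (α ∸ᶠ β)))))) (below α)) ⟩
    sumℤ (map (λ β → + (χ A (coeff β) * χ B (coeff (α ∸ᶠ β)))) (below α))
      ≡⟨ sumℤ-+ (below α) (λ β → χ A (coeff β) * χ B (coeff (α ∸ᶠ β))) ⟩
    + ∑[ β ∈ below α ] (χ A (coeff β) * χ B (coeff (α ∸ᶠ β)))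
      ≡⟨ cong +_ counting ⟩
    + χ⊗ A B (coeff α) ∎
    where
    colsA = allVec N (∣V∣ A)
    colsB = allVec N (∣V∣ B)
    pA : Vec (Fin N) (∣V∣ A) → ℕ
    pA κ = ⟦ proper A κ ⟧
    pB : Vec (Fin N) (∣V∣ B) → ℕ
    pB κ = ⟦ proper B κ ⟧
    pair : Vec (Fin N) (∣V∣ A) → (Fin N → ℕ) → Vec (Fin N) (∣V∣ B) → ℕ
    pair κ β κ′ = (pA κ * coeff β (content κ)) * (pB κ′ * coeff (α ∸ᶠ β) (content κ′))
    convolution : ∀ κ κ′ → ∑[ β ∈ below α ] (coeff β (content κ) * coeff (α ∸ᶠ β) (content κ′))
                         ≡ coeff α (content κ ⊞ content κ′)
    convolution κ κ′ = trans (∑-below-convolution N α (lookup (content κ)) (lookup (content κ′)))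
      (cong ⟦_⟧ (allB-cong (allFin N) (λ i → cong (_==ℕ α i) (sym (lookup-zipWith _+_ i (content κ) (content κ′))))))
    counting : ∑[ β ∈ below α ] (χ A (coeff β) * χ B (coeff (α ∸ᶠ β))) ≡ χ⊗ A B (coeff α)
    counting = begin
      ∑[ β ∈ below α ] (χ A (coeff β) * χ B (coeff (α ∸ᶠ β)))
        ≡⟨ ∑-cong (below α) (λ β → ∑-*-∑ colsA colsB _ _) ⟩
      ∑[ β ∈ below α ] ∑[ κ ∈ colsA ] ∑[ κ′ ∈ colsB ] pair κ β κ′
        ≡⟨ ∑-swap (below α) colsA _ ⟩
      ∑[ κ ∈ colsA ] ∑[ β ∈ below α ] ∑[ κ′ ∈ colsB ] pair κ β κ′
        ≡⟨ ∑-cong colsA (λ κ → ∑-swap (below α) colsB _) ⟩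
      ∑[ κ ∈ colsA ] ∑[ κ′ ∈ colsB ] ∑[ β ∈ below α ] pair κ β κ′
        ≡⟨ ∑-cong colsA (λ κ → ∑-cong colsB (λ κ′ →
             trans (∑-cong (below α) (λ β → *-interchange (pA κ) _ (pB κ′) _))
            (trans (∑-*ˡ (below α) (pA κ * pB κ′) _)
                   (cong (pA κ * pB κ′ *_) (convolution κ κ′))))) ⟩
      ∑[ κ ∈ colsA ] ∑[ κ′ ∈ colsB ] (pA κ * pB κ′ * coeff α (content κ ⊞ content κ′))
        ≡⟨ ∑-cong colsA (λ κ → trans (∑-cong colsB (λ κ′ → *-assoc (pA κ) _ _)) (∑-*ˡ colsB (pA κ) _)) ⟩
      χ⊗ A B (coeff α) ∎

  χ-glue : ∀ G T (f : Weight N) →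
    χ (glue G T) f ≡ ∑[ κ ∈ allVec N (∣V∣ G) ] (⟦ proper G κ ⟧ * χᵣ T (lookup κ (root G)) (λ t → f (content κ ⊞ t)))
  χ-glue G T f =
    trans (∑-allVec-++ (∣V∣ G) (m T) (λ κ → ⟦ proper (glue G T) κ ⟧ * f (content κ))) (∑-cong (allVec N (∣V∣ G)) (λ κ →
    trans (∑-cong (allVec N (m T)) (λ κ′ → begin
      ⟦ proper (glue G T) (κ ++ᵥ κ′) ⟧ * f (content (κ ++ᵥ κ′))
        ≡⟨ cong₂ (λ p s → ⟦ p ⟧ * f s) (proper-glue G T κ κ′) (content-++ κ κ′) ⟩
      ⟦ proper G κ ∧ proper T (insertAt κ′ (root T) (lookup κ (root G))) ⟧ * f (content κ ⊞ content κ′)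
        ≡⟨ cong (_* f (content κ ⊞ content κ′)) (⟦∧⟧ (proper G κ) _) ⟩
      ⟦ proper G κ ⟧ * ⟦ proper T (insertAt κ′ (root T) (lookup κ (root G))) ⟧ * f (content κ ⊞ content κ′)
        ≡⟨ *-assoc ⟦ proper G κ ⟧ _ _ ⟩
      ⟦ proper G κ ⟧ * (⟦ proper T (insertAt κ′ (root T) (lookup κ (root G))) ⟧ * f (content κ ⊞ content κ′)) ∎))
    (∑-*ˡ (allVec N (m T)) ⟦ proper G κ ⟧ _)))

  χᵣ-addLeaf : ∀ T c (g : Weight N) →
    χᵣ (addLeaf T) c g ≡ ∑[ y ∈ allFin N ] (⟦ c ≠ᵇ y ⟧ * χᵣ T y (λ t → g (δ y ⊞ t)))
  χᵣ-addLeaf T c g = begin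
    ∑[ κ ∈ allVec N (∣V∣ T) ] (⟦ proper (addLeaf T) (c ∷ κ) ⟧ * g (content κ))
      ≡⟨ ∑-allVec-insertAt (m T) (root T) (λ κ → ⟦ proper (addLeaf T) (c ∷ κ) ⟧ * g (content κ)) ⟩
    ∑[ y ∈ allFin N ] ∑[ κ ∈ allVec N (m T) ] (⟦ proper (addLeaf T) (c ∷ ins κ y) ⟧ * g (content (ins κ y)))
      ≡⟨ ∑-cong (allFin N) (λ y →
           trans (∑-cong (allVec N (m T)) (term y))
                 (∑-*ˡ (allVec N (m T)) ⟦ c ≠ᵇ y ⟧ (λ κ → ⟦ proper T (ins κ y) ⟧ * g (δ y ⊞ content κ)))) ⟩
    ∑[ y ∈ allFin N ] (⟦ c ≠ᵇ y ⟧ * χᵣ T y (λ t → g (δ y ⊞ t))) ∎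
    where
    ins : Vec (Fin N) (m T) → Fin N → Vec (Fin N) (∣V∣ T)
    ins κ y = insertAt κ (root T) y
    term : ∀ y κ → ⟦ proper (addLeaf T) (c ∷ ins κ y) ⟧ * g (content (ins κ y))
                 ≡ ⟦ c ≠ᵇ y ⟧ * (⟦ proper T (ins κ y) ⟧ * g (δ y ⊞ content κ))
    term y κ = begin
      ⟦ proper (addLeaf T) (c ∷ ins κ y) ⟧ * g (content (ins κ y))
        ≡⟨ cong₂ (λ p s → ⟦ p ⟧ * g s) (proper-addLeaf T c (ins κ y)) (content-insertAt κ (root T) y) ⟩
      ⟦ c ≠ᵇ lookup (ins κ y) (root T) ∧ proper T (ins κ y) ⟧ * g (δ y ⊞ content κ)
        ≡⟨ cong (λ x → ⟦ c ≠ᵇ x ∧ proper T (ins κ y) ⟧ * g (δ y ⊞ content κ)) (insertAt-lookup κ (root T) y) ⟩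
      ⟦ c ≠ᵇ y ∧ proper T (ins κ y) ⟧ * g (δ y ⊞ content κ)
        ≡⟨ cong (_* g (δ y ⊞ content κ)) (⟦∧⟧ (c ≠ᵇ y) _) ⟩
      ⟦ c ≠ᵇ y ⟧ * ⟦ proper T (ins κ y) ⟧ * g (δ y ⊞ content κ)
        ≡⟨ *-assoc ⟦ c ≠ᵇ y ⟧ _ _ ⟩
      ⟦ c ≠ᵇ y ⟧ * (⟦ proper T (ins κ y) ⟧ * g (δ y ⊞ content κ)) ∎

  χᵣ-path : ∀ L c (g : Weight N) →
    χᵣ (tailPath K₁ L) c g ≡ ∑[ π ∈ allVec N L ] (⟦ properPath (c ∷ π) ⟧ * g (content π))
  χᵣ-path zero    c g = refl
  χᵣ-path (suc L) c g = begin
    χᵣ (addLeaf (tailPath K₁ L)) c g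
      ≡⟨ χᵣ-addLeaf (tailPath K₁ L) c g ⟩
    ∑[ y ∈ allFin N ] (⟦ c ≠ᵇ y ⟧ * χᵣ (tailPath K₁ L) y (λ t → g (δ y ⊞ t)))
      ≡⟨ ∑-cong (allFin N) (λ y → cong (⟦ c ≠ᵇ y ⟧ *_) (χᵣ-path L y (λ t → g (δ y ⊞ t)))) ⟩
    ∑[ y ∈ allFin N ] (⟦ c ≠ᵇ y ⟧ * ∑[ π ∈ allVec N L ] (⟦ properPath (y ∷ π) ⟧ * g (δ y ⊞ content π)))
      ≡⟨ ∑-cong (allFin N) (λ y → trans (sym (∑-*ˡ (allVec N L) ⟦ c ≠ᵇ y ⟧ _)) (∑-cong (allVec N L) (λ π →
           trans (sym (*-assoc ⟦ c ≠ᵇ y ⟧ _ _)) (cong (_* g (δ y ⊞ content π)) (sym (⟦∧⟧ (c ≠ᵇ y) _)))))) ⟩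
    ∑[ y ∈ allFin N ] ∑[ π ∈ allVec N L ] (⟦ properPath (c ∷ y ∷ π) ⟧ * g (content (y ∷ π)))
      ≡⟨ ∑-allVec-∷ L (λ π → ⟦ properPath (c ∷ π) ⟧ * g (content π)) ⟨
    ∑[ π ∈ allVec N (suc L) ] (⟦ properPath (c ∷ π) ⟧ * g (content π)) ∎

  χᵣ-rootColour : ∀ T c (f : Weight N) →
      χᵣ T c (λ t → f (δ c ⊞ t))
    ≡ ∑[ κ ∈ allVec N (∣V∣ T) ] (⟦ proper T κ ⟧ * (⟦ lookup κ (root T) ==ᵇ c ⟧ * f (content κ)))
  χᵣ-rootColour T c f = sym (begin
    ∑[ κ ∈ allVec N (∣V∣ T) ] (⟦ proper T κ ⟧ * (⟦ lookup κ (root T) ==ᵇ c ⟧ * f (content κ)))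
      ≡⟨ ∑-allVec-insertAt (m T) (root T) (λ κ → ⟦ proper T κ ⟧ * (⟦ lookup κ (root T) ==ᵇ c ⟧ * f (content κ))) ⟩
    ∑[ y ∈ allFin N ] ∑[ κ ∈ allVec N (m T) ]
      (⟦ proper T (ins κ y) ⟧ * (⟦ lookup (ins κ y) (root T) ==ᵇ c ⟧ * f (content (ins κ y))))
      ≡⟨ ∑-cong (allFin N) (λ y →
           trans (∑-cong (allVec N (m T)) (term y))
                 (∑-*ˡ (allVec N (m T)) ⟦ y ==ᵇ c ⟧ (λ κ → ⟦ proper T (ins κ y) ⟧ * f (δ y ⊞ content κ)))) ⟩
    ∑[ y ∈ allFin N ] (⟦ y ==ᵇ c ⟧ * χᵣ T y (λ t → f (δ y ⊞ t)))
      ≡⟨ ∑-δ N c (λ y → χᵣ T y (λ t → f (δ y ⊞ t))) ⟩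
    χᵣ T c (λ t → f (δ c ⊞ t)) ∎)
    where
    ins : Vec (Fin N) (m T) → Fin N → Vec (Fin N) (∣V∣ T)
    ins κ y = insertAt κ (root T) y
    term : ∀ y κ → ⟦ proper T (ins κ y) ⟧ * (⟦ lookup (ins κ y) (root T) ==ᵇ c ⟧ * f (content (ins κ y)))
                 ≡ ⟦ y ==ᵇ c ⟧ * (⟦ proper T (ins κ y) ⟧ * f (δ y ⊞ content κ))
    term y κ = trans (cong₂ (λ x s → ⟦ proper T (ins κ y) ⟧ * (⟦ x ==ᵇ c ⟧ * f s))
                            (insertAt-lookup κ (root T) y) (content-insertAt κ (root T) y))
                     (*-left-comm ⟦ proper T (ins κ y) ⟧ ⟦ y ==ᵇ c ⟧ (f (δ y ⊞ content κ)))

-- Vertices hanging at a coloured vertex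

Attachment : ℕ → Set
Attachment N = Fin N → Content N → ℕ

module _ {N : ℕ} where

  attach : ∀ {q} → (Fin N → Vec (Fin N) q → Bool) → Weight N → Attachment N
  attach {q} Ψ f c s = ∑[ κ ∈ allVec N q ] (⟦ Ψ c κ ⟧ * f (s ⊞ content κ))

  cycleThrough pathFrom : ∀ {q} → Fin N → Vec (Fin N) q → Bool
  cycleThrough c κ = properCycle (c ∷ κ)
  pathFrom     c κ = properPath (c ∷ κ)

  cycleApart cycleBeyond : ∀ {q} → Fin N → Vec (Fin N) (suc q) → Bool
  cycleApart  _ κ = properCycle κ
  cycleBeyond c κ = c ≠ᵇ head κ ∧ properCycle κ

  attach-cong : ∀ {q} (Ψ Φ : Fin N → Vec (Fin N) q → Bool) f c s →
    (∀ κ → Ψ c κ ≡ Φ c κ) → attach Ψ f c s ≡ attach Φ f c s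
  attach-cong {q} Ψ Φ f c s Ψ≗Φ = ∑-cong (allVec N q) (λ κ → cong (λ b → ⟦ b ⟧ * f (s ⊞ content κ)) (Ψ≗Φ κ))

  attach-∷ : ∀ {q} (Ψ : Fin N → Vec (Fin N) q → Bool) f c s →
      ∑[ z ∈ allFin N ] (⟦ c ≠ᵇ z ⟧ * attach Ψ f z (s ⊞ δ z))
    ≡ attach (λ c κ → c ≠ᵇ head κ ∧ Ψ (head κ) (tail κ)) f c s
  attach-∷ {q} Ψ f c s =
    sym (trans (∑-allVec-∷ q (λ κ → ⟦ c ≠ᵇ head κ ∧ Ψ (head κ) (tail κ) ⟧ * f (s ⊞ content κ)))
               (∑-cong (allFin N) (λ z →
    trans (∑-cong (allVec N q) (λ κ → begin
      ⟦ c ≠ᵇ z ∧ Ψ z κ ⟧ * f (s ⊞ (δ z ⊞ content κ))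
        ≡⟨ cong₂ _*_ (⟦∧⟧ (c ≠ᵇ z) (Ψ z κ)) (cong f (sym (⊞-assoc s (δ z) (content κ)))) ⟩
      ⟦ c ≠ᵇ z ⟧ * ⟦ Ψ z κ ⟧ * f (s ⊞ δ z ⊞ content κ)
        ≡⟨ *-assoc ⟦ c ≠ᵇ z ⟧ _ _ ⟩
      ⟦ c ≠ᵇ z ⟧ * (⟦ Ψ z κ ⟧ * f (s ⊞ δ z ⊞ content κ)) ∎))
    (∑-*ˡ (allVec N q) ⟦ c ≠ᵇ z ⟧ (λ κ → ⟦ Ψ z κ ⟧ * f (s ⊞ δ z ⊞ content κ))))))

  attach-reverse : ∀ {q} f c s →
      attach {suc q} (λ c κ → properPath κ ∧ c ==ᵇ last κ) f c s
    ≡ attach {suc q} (λ c κ → properPath κ ∧ c ==ᵇ head κ) f c s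
  attach-reverse {q} f c s =
    trans (sym (∑-allVec-reverse (suc q) (λ κ → ⟦ properPath κ ∧ c ==ᵇ last κ ⟧ * f (s ⊞ content κ))))
          (∑-cong (allVec N (suc q)) (λ κ →
    cong₂ (λ p t → ⟦ p ⟧ * f (s ⊞ t))
          (cong₂ (λ p x → p ∧ c ==ᵇ x) (properPath-reverse κ) (last-reverse κ))
          (content-reverse κ)))

three-colours : ∀ {N} P (a b c : Fin N) →
    ⟦ (c ≠ᵇ a ∧ P) ∧ c ≠ᵇ b ⟧ + ⟦ P ∧ b ≠ᵇ a ⟧ + ⟦ P ∧ c ==ᵇ b ⟧
  ≡ ⟦ c ≠ᵇ a ∧ P ∧ b ≠ᵇ a ⟧ + ⟦ c ≠ᵇ a ∧ P ⟧ + ⟦ P ∧ c ==ᵇ a ⟧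
three-colours P a b c with c Fin.≟ a | c Fin.≟ b | b Fin.≟ a
... | yes c≡a | yes c≡b | no  b≢a = contradiction (trans (sym c≡b) c≡a) b≢a
... | yes c≡a | no  c≢b | yes b≡a = contradiction (trans c≡a (sym b≡a)) c≢b
... | no  c≢a | yes c≡b | yes b≡a = contradiction (trans c≡b b≡a) c≢a
three-colours true  a b c | yes _ | yes _ | yes _ = refl
three-colours false a b c | yes _ | yes _ | yes _ = refl
three-colours true  a b c | yes _ | no  _ | no  _ = refl
three-colours false a b c | yes _ | no  _ | no  _ = refl
three-colours true  a b c | no  _ | yes _ | no  _ = refl
three-colours false a b c | no  _ | yes _ | no  _ = refl
three-colours true  a b c | no  _ | no  _ | yes _ = refl
three-colours false a b c | no  _ | no  _ | yes _ = refl
three-colours true  a b c | no  _ | no  _ | no  _ = refl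
three-colours false a b c | no  _ | no  _ | no  _ = refl

module _ {N : ℕ} where

  -- Pointwise the identity needs [c = last κ] on the left and [c = head κ] on the right; reversal equates them.
  cycle-exchange : ∀ {n} (f : Weight N) c s →
      attach {q = suc n} cycleThrough f c s + attach {q = suc n} cycleApart f c s
    ≡ attach {q = suc n} cycleBeyond f c s + attach {q = suc n} pathFrom f c s
  cycle-exchange {n} f c s = +-cancelʳ-≡ _ _ _ (begin
    attachₙ cycleThrough f c s + attachₙ cycleApart f c s + attachₙ endsAt f c s
      ≡⟨ sum₃ cycleThrough cycleApart endsAt ⟩
    ∑[ κ ∈ cols ] ((⟦ cycleThrough c κ ⟧ + ⟦ cycleApart c κ ⟧ + ⟦ endsAt c κ ⟧) * w κ)
      ≡⟨ ∑-cong cols (λ κ → cong (_* w κ) (pointwise κ)) ⟩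
    ∑[ κ ∈ cols ] ((⟦ cycleBeyond c κ ⟧ + ⟦ pathFrom c κ ⟧ + ⟦ startsAt c κ ⟧) * w κ)
      ≡⟨ sum₃ cycleBeyond pathFrom startsAt ⟨
    attachₙ cycleBeyond f c s + attachₙ pathFrom f c s + attachₙ startsAt f c s
      ≡⟨ cong (_+_ (attachₙ cycleBeyond f c s + attachₙ pathFrom f c s)) (attach-reverse f c s) ⟨
    attachₙ cycleBeyond f c s + attachₙ pathFrom f c s + attachₙ endsAt f c s ∎)
    where
    cols = allVec N (suc n)
    attachₙ : (Fin N → Vec (Fin N) (suc n) → Bool) → Weight N → Attachment N
    attachₙ = attach
    w : Vec (Fin N) (suc n) → ℕ
    w κ = f (s ⊞ content κ)
    endsAt startsAt : Fin N → Vec (Fin N) (suc n) → Bool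
    endsAt   c κ = properPath κ ∧ c ==ᵇ last κ
    startsAt c κ = properPath κ ∧ c ==ᵇ head κ
    sum₃ : ∀ (Ψ Φ Θ : Fin N → Vec (Fin N) (suc n) → Bool) → attachₙ Ψ f c s + attachₙ Φ f c s + attachₙ Θ f c s
                   ≡ ∑[ κ ∈ cols ] ((⟦ Ψ c κ ⟧ + ⟦ Φ c κ ⟧ + ⟦ Θ c κ ⟧) * w κ)
    sum₃ Ψ Φ Θ = sym (begin
      ∑[ κ ∈ cols ] ((⟦ Ψ c κ ⟧ + ⟦ Φ c κ ⟧ + ⟦ Θ c κ ⟧) * w κ)
        ≡⟨ ∑-cong cols (λ κ → trans (*-distribʳ-+ (w κ) (⟦ Ψ c κ ⟧ + ⟦ Φ c κ ⟧) _)
                                    (cong (_+ ⟦ Θ c κ ⟧ * w κ) (*-distribʳ-+ (w κ) ⟦ Ψ c κ ⟧ _))) ⟩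
      ∑[ κ ∈ cols ] (⟦ Ψ c κ ⟧ * w κ + ⟦ Φ c κ ⟧ * w κ + ⟦ Θ c κ ⟧ * w κ)
        ≡⟨ ∑-+ cols (λ κ → ⟦ Ψ c κ ⟧ * w κ + ⟦ Φ c κ ⟧ * w κ) _ ⟩
      ∑[ κ ∈ cols ] (⟦ Ψ c κ ⟧ * w κ + ⟦ Φ c κ ⟧ * w κ) + attachₙ Θ f c s
        ≡⟨ cong (_+ attachₙ Θ f c s) (∑-+ cols (λ κ → ⟦ Ψ c κ ⟧ * w κ) _) ⟩
      attachₙ Ψ f c s + attachₙ Φ f c s + attachₙ Θ f c s ∎)
    pointwise : ∀ κ → ⟦ cycleThrough c κ ⟧ + ⟦ cycleApart c κ ⟧ + ⟦ endsAt c κ ⟧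
                    ≡ ⟦ cycleBeyond c κ ⟧ + ⟦ pathFrom c κ ⟧ + ⟦ startsAt c κ ⟧
    pointwise (a ∷ κ) =
      trans (cong (λ x → ⟦ (c ≠ᵇ a ∧ properPath (a ∷ κ)) ∧ x ⟧ + ⟦ cycleApart c (a ∷ κ) ⟧ + ⟦ endsAt c (a ∷ κ) ⟧)
                  (≠ᵇ-sym (last (a ∷ κ)) c))
            (three-colours (properPath (a ∷ κ)) a (last (a ∷ κ)) c)

-- Colourings of H with a tail

module TailSums {N : ℕ} (H : RGraph) where

  rootColour : Vec (Fin N) (∣V∣ H) → Fin N
  rootColour κ = lookup κ (root H)

  tailWeight : ∀ {k} → Vec (Fin N) (∣V∣ H) → Vec (Fin N) k → ℕ
  tailWeight κ ρ = ⟦ proper H κ ⟧ * ⟦ properPath (rootColour κ ∷ ρ) ⟧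

  tip : ∀ {k} → Vec (Fin N) (∣V∣ H) → Vec (Fin N) k → Fin N
  tip κ ρ = last (rootColour κ ∷ ρ)

  -- A colouring of H^k: κ colours H, and ρ the tail from the root of H outwards.
  tailSum : ℕ → Attachment N → ℕ
  tailSum k F = ∑[ κ ∈ allVec N (∣V∣ H) ] ∑[ ρ ∈ allVec N k ] (tailWeight κ ρ * F (tip κ ρ) (content κ ⊞ content ρ))

  module _ (k : ℕ) where

    tailSum-cong : ∀ {F G : Attachment N} → (∀ c s → F c s ≡ G c s) → tailSum k F ≡ tailSum k G
    tailSum-cong F≗G = ∑-cong (allVec N (∣V∣ H)) (λ κ → ∑-cong (allVec N k) (λ ρ →
      cong (tailWeight κ ρ *_) (F≗G (tip κ ρ) (content κ ⊞ content ρ))))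

    tailSum-*ˡ : ∀ a (F : Attachment N) → a * tailSum k F ≡ tailSum k (λ c s → a * F c s)
    tailSum-*ˡ a F = trans (sym (∑-*ˡ (allVec N (∣V∣ H)) a _)) (∑-cong (allVec N (∣V∣ H)) (λ κ →
      trans (sym (∑-*ˡ (allVec N k) a _))
            (∑-cong (allVec N k) (λ ρ → *-left-comm a (tailWeight κ ρ) (F (tip κ ρ) (content κ ⊞ content ρ))))))

    tailSum-∑ : ∀ {A : Set} (xs : List A) (F : A → Attachment N) →
      ∑[ x ∈ xs ] tailSum k (F x) ≡ tailSum k (λ c s → ∑[ x ∈ xs ] F x c s)
    tailSum-∑ xs F = trans (∑-swap xs (allVec N (∣V∣ H)) _) (∑-cong (allVec N (∣V∣ H)) (λ κ →
      trans (∑-swap xs (allVec N k) _)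
            (∑-cong (allVec N k) (λ ρ → ∑-*ˡ xs (tailWeight κ ρ) (λ x → F x (tip κ ρ) (content κ ⊞ content ρ))))))

    tailSum-+ : ∀ (F G : Attachment N) → tailSum k F + tailSum k G ≡ tailSum k (λ c s → F c s + G c s)
    tailSum-+ F G = trans (sym (∑-+ (allVec N (∣V∣ H)) _ _)) (∑-cong (allVec N (∣V∣ H)) (λ κ →
      trans (sym (∑-+ (allVec N k) _ _))
            (∑-cong (allVec N k) (λ ρ → sym (*-distribˡ-+ (tailWeight κ ρ) (F (tip κ ρ) _) (G (tip κ ρ) _))))))

  tailSum-++ : ∀ k q (F : Attachment N) → tailSum (k + q) F
    ≡ tailSum k (λ c s → ∑[ π ∈ allVec N q ] (⟦ properPath (c ∷ π) ⟧ * F (last (c ∷ π)) (s ⊞ content π)))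
  tailSum-++ k q F = ∑-cong (allVec N (∣V∣ H)) (λ κ → trans (∑-allVec-++ k q _) (∑-cong (allVec N k) (λ ρ →
    trans (∑-cong (allVec N q) (split κ ρ)) (∑-*ˡ (allVec N q) (tailWeight κ ρ) _))))
    where
    split : ∀ κ ρ π → tailWeight κ (ρ ++ᵥ π) * F (tip κ (ρ ++ᵥ π)) (content κ ⊞ content (ρ ++ᵥ π))
                    ≡ tailWeight κ ρ * (⟦ properPath (tip κ ρ ∷ π) ⟧
                                        * F (last (tip κ ρ ∷ π)) (content κ ⊞ content ρ ⊞ content π))
    split κ ρ π = begin
      ⟦ proper H κ ⟧ * ⟦ properPath (rootColour κ ∷ ρ ++ᵥ π) ⟧ * F (tip κ (ρ ++ᵥ π)) (content κ ⊞ content (ρ ++ᵥ π))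
        ≡⟨ cong₂ (λ p c → ⟦ proper H κ ⟧ * ⟦ p ⟧ * F c (content κ ⊞ content (ρ ++ᵥ π)))
                 (properPath-++ (rootColour κ) ρ π) (last-++ (rootColour κ) ρ π) ⟩
      ⟦ proper H κ ⟧ * ⟦ inner ∧ outer ⟧ * F c′ (content κ ⊞ content (ρ ++ᵥ π))
        ≡⟨ cong₂ (λ x t → ⟦ proper H κ ⟧ * x * F c′ t) (⟦∧⟧ inner outer)
                 (trans (cong (content κ ⊞_) (content-++ ρ π)) (sym (⊞-assoc (content κ) _ _))) ⟩
      ⟦ proper H κ ⟧ * (⟦ inner ⟧ * ⟦ outer ⟧) * F c′ s′
        ≡⟨ cong (_* F c′ s′) (*-assoc ⟦ proper H κ ⟧ _ _) ⟨
      tailWeight κ ρ * ⟦ outer ⟧ * F c′ s′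
        ≡⟨ *-assoc (tailWeight κ ρ) _ _ ⟩
      tailWeight κ ρ * (⟦ outer ⟧ * F c′ s′) ∎
      where
      inner = properPath (rootColour κ ∷ ρ)
      outer = properPath (tip κ ρ ∷ π)
      c′ = last (tip κ ρ ∷ π)
      s′ = content κ ⊞ content ρ ⊞ content π

  tailSum-suc : ∀ k (F : Attachment N) →
    tailSum (suc k) F ≡ tailSum k (λ c s → ∑[ z ∈ allFin N ] (⟦ c ≠ᵇ z ⟧ * F z (s ⊞ δ z)))
  tailSum-suc k F = begin
    tailSum (suc k) F
      ≡⟨ cong (λ n → tailSum n F) (+-comm 1 k) ⟩
    tailSum (k + 1) F
      ≡⟨ tailSum-++ k 1 F ⟩
    tailSum k (λ c s → ∑[ π ∈ allVec N 1 ] (⟦ properPath (c ∷ π) ⟧ * F (last (c ∷ π)) (s ⊞ content π)))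
      ≡⟨ tailSum-cong k (λ c s →
           trans (∑-allVec-∷ 0 (λ π → ⟦ properPath (c ∷ π) ⟧ * F (last (c ∷ π)) (s ⊞ content π))) (∑-cong (allFin N) (λ z →
           trans (∑-allVec-[] (λ π → ⟦ properPath (c ∷ z ∷ π) ⟧ * F (last (z ∷ π)) (s ⊞ content (z ∷ π))))
                 (cong₂ (λ p t → ⟦ p ⟧ * F z (s ⊞ t)) (∧-identityʳ (c ≠ᵇ z)) (⊞-identityʳ (δ z)))))) ⟩
    tailSum k (λ c s → ∑[ z ∈ allFin N ] (⟦ c ≠ᵇ z ⟧ * F z (s ⊞ δ z))) ∎

  χᵣ-tailPath : ∀ k c (f : Weight N) →
    χᵣ (tailPath H k) c (λ t → f (δ c ⊞ t)) ≡ tailSum k (λ e s → ⟦ e ==ᵇ c ⟧ * f s)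
  χᵣ-tailPath zero    c f = trans (χᵣ-rootColour H c f) (∑-cong (allVec N (∣V∣ H)) (λ κ → sym
    (trans (∑-allVec-[] (λ ρ → tailWeight κ ρ * (⟦ tip κ ρ ==ᵇ c ⟧ * f (content κ ⊞ content ρ))))
           (cong₂ (λ w s → w * (⟦ rootColour κ ==ᵇ c ⟧ * f s))
                  (*-identityʳ ⟦ proper H κ ⟧) (⊞-identityʳ (content κ))))))
  χᵣ-tailPath (suc k) c f = begin
    χᵣ (addLeaf (tailPath H k)) c (λ t → f (δ c ⊞ t))
      ≡⟨ χᵣ-addLeaf (tailPath H k) c (λ t → f (δ c ⊞ t)) ⟩
    ∑[ y ∈ allFin N ] (⟦ c ≠ᵇ y ⟧ * χᵣ (tailPath H k) y (λ t → f (δ c ⊞ (δ y ⊞ t))))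
      ≡⟨ ∑-cong (allFin N) (λ y → cong (⟦ c ≠ᵇ y ⟧ *_) (χᵣ-tailPath k y (λ s → f (δ c ⊞ s)))) ⟩
    ∑[ y ∈ allFin N ] (⟦ c ≠ᵇ y ⟧ * tailSum k (λ e s → ⟦ e ==ᵇ y ⟧ * f (δ c ⊞ s)))
      ≡⟨ ∑-cong (allFin N) (λ y → tailSum-*ˡ k ⟦ c ≠ᵇ y ⟧ (λ e s → ⟦ e ==ᵇ y ⟧ * f (δ c ⊞ s))) ⟩
    ∑[ y ∈ allFin N ] tailSum k (λ e s → ⟦ c ≠ᵇ y ⟧ * (⟦ e ==ᵇ y ⟧ * f (δ c ⊞ s)))
      ≡⟨ tailSum-∑ k (allFin N) (λ y e s → ⟦ c ≠ᵇ y ⟧ * (⟦ e ==ᵇ y ⟧ * f (δ c ⊞ s))) ⟩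
    tailSum k (λ e s → ∑[ y ∈ allFin N ] (⟦ c ≠ᵇ y ⟧ * (⟦ e ==ᵇ y ⟧ * f (δ c ⊞ s))))
      ≡⟨ tailSum-cong k oldRoot ⟩
    tailSum k (λ e s → ⟦ c ≠ᵇ e ⟧ * f (δ c ⊞ s))
      ≡⟨ tailSum-cong k newTip ⟨
    tailSum k (λ e s → ∑[ z ∈ allFin N ] (⟦ e ≠ᵇ z ⟧ * (⟦ z ==ᵇ c ⟧ * f (s ⊞ δ z))))
      ≡⟨ tailSum-suc k (λ e s → ⟦ e ==ᵇ c ⟧ * f s) ⟨
    tailSum (suc k) (λ e s → ⟦ e ==ᵇ c ⟧ * f s) ∎
    where
    oldRoot : ∀ e s → ∑[ y ∈ allFin N ] (⟦ c ≠ᵇ y ⟧ * (⟦ e ==ᵇ y ⟧ * f (δ c ⊞ s))) ≡ ⟦ c ≠ᵇ e ⟧ * f (δ c ⊞ s)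
    oldRoot e s = trans (∑-cong (allFin N) (λ y → trans (*-left-comm ⟦ c ≠ᵇ y ⟧ ⟦ e ==ᵇ y ⟧ (f (δ c ⊞ s)))
                                                        (cong (λ b → ⟦ b ⟧ * (⟦ c ≠ᵇ y ⟧ * f (δ c ⊞ s))) (==ᵇ-sym e y))))
                        (∑-δ N e (λ y → ⟦ c ≠ᵇ y ⟧ * f (δ c ⊞ s)))
    newTip : ∀ e s → ∑[ z ∈ allFin N ] (⟦ e ≠ᵇ z ⟧ * (⟦ z ==ᵇ c ⟧ * f (s ⊞ δ z))) ≡ ⟦ c ≠ᵇ e ⟧ * f (δ c ⊞ s)
    newTip e s = trans (∑-cong (allFin N) (λ z → *-left-comm ⟦ e ≠ᵇ z ⟧ ⟦ z ==ᵇ c ⟧ (f (s ⊞ δ z))))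
                (trans (∑-δ N c (λ z → ⟦ e ≠ᵇ z ⟧ * f (s ⊞ δ z)))
                       (cong₂ (λ p t → ⟦ p ⟧ * f t) (≠ᵇ-sym e c) (⊞-comm s (δ c))))

  χ-tailed : ∀ L (f : Weight N) → χ (tailed H L) f ≡ tailSum L (λ _ s → f s)
  χ-tailed L f = trans (χ-glue H (tailPath K₁ L) f) (∑-cong (allVec N (∣V∣ H)) (λ κ →
    trans (cong (⟦ proper H κ ⟧ *_) (χᵣ-path L (rootColour κ) (λ t → f (content κ ⊞ t))))
   (trans (sym (∑-*ˡ (allVec N L) ⟦ proper H κ ⟧ (λ ρ → ⟦ properPath (rootColour κ ∷ ρ) ⟧ * f (content κ ⊞ content ρ))))
          (∑-cong (allVec N L) (λ ρ → sym (*-assoc ⟦ proper H κ ⟧ _ _))))))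

  χ-P : ∀ j k (f : Weight N) → χ (P k (C (2 + j)) H) f ≡ tailSum k (attach {q = suc j} cycleThrough f)
  χ-P j k f = begin
    χ (glue (cyc j) (tailPath H k)) f
      ≡⟨ χ-glue (cyc j) (tailPath H k) f ⟩
    ∑[ κ ∈ allVec N (2 + j) ] (⟦ proper (cyc j) κ ⟧ * χᵣ (tailPath H k) (lookup κ zero) (λ t → f (content κ ⊞ t)))
      ≡⟨ ∑-allVec-∷ {N} (suc j) _ ⟩
    ∑[ c ∈ allFin N ] ∑[ κ ∈ cols ] (⟦ proper (cyc j) (c ∷ κ) ⟧ * χᵣ (tailPath H k) c (λ t → f (δ c ⊞ content κ ⊞ t)))
      ≡⟨ ∑-cong (allFin N) (λ c → ∑-cong cols (λ κ → cong₂ _*_ (cong ⟦_⟧ (proper-cyc j (c ∷ κ)))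
           (trans (χᵣ-cong (tailPath H k) c (λ t → cong f (⊞.xy∙z≈xz∙y (δ c) (content κ) t)))
                  (χᵣ-tailPath k c (λ s → f (s ⊞ content κ)))))) ⟩
    ∑[ c ∈ allFin N ] ∑[ κ ∈ cols ] (⟦ cycleThrough c κ ⟧ * tailSum k (λ e s → ⟦ e ==ᵇ c ⟧ * f (s ⊞ content κ)))
      ≡⟨ ∑-cong (allFin N) (λ c → trans (∑-cong cols (λ κ → tailSum-*ˡ k ⟦ cycleThrough c κ ⟧ (term c κ)))
                                         (tailSum-∑ k cols (λ κ e s → ⟦ cycleThrough c κ ⟧ * term c κ e s))) ⟩
    ∑[ c ∈ allFin N ] tailSum k (λ e s → ∑[ κ ∈ cols ] (⟦ cycleThrough c κ ⟧ * (⟦ e ==ᵇ c ⟧ * f (s ⊞ content κ))))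
      ≡⟨ tailSum-∑ k (allFin N) (λ c e s → ∑[ κ ∈ cols ] (⟦ cycleThrough c κ ⟧ * term c κ e s)) ⟩
    tailSum k (λ e s → ∑[ c ∈ allFin N ] ∑[ κ ∈ cols ] (⟦ cycleThrough c κ ⟧ * (⟦ e ==ᵇ c ⟧ * f (s ⊞ content κ))))
      ≡⟨ tailSum-cong k (λ e s → trans (∑-cong (allFin N) (select e s)) (∑-δ N e (λ c → cycles c s))) ⟩
    tailSum k cycles ∎
    where
    cols = allVec N (suc j)
    cycles : Attachment N
    cycles = attach {q = suc j} cycleThrough f
    term : Fin N → Vec (Fin N) (suc j) → Attachment N
    term c κ e s = ⟦ e ==ᵇ c ⟧ * f (s ⊞ content κ)
    select : ∀ e s c → ∑[ κ ∈ cols ] (⟦ cycleThrough c κ ⟧ * (⟦ e ==ᵇ c ⟧ * f (s ⊞ content κ)))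
                     ≡ ⟦ c ==ᵇ e ⟧ * cycles c s
    select e s c = begin
      ∑[ κ ∈ cols ] (⟦ cycleThrough c κ ⟧ * (⟦ e ==ᵇ c ⟧ * f (s ⊞ content κ)))
        ≡⟨ ∑-cong cols (λ κ → *-left-comm ⟦ cycleThrough c κ ⟧ ⟦ e ==ᵇ c ⟧ (f (s ⊞ content κ))) ⟩
      ∑[ κ ∈ cols ] (⟦ e ==ᵇ c ⟧ * (⟦ cycleThrough c κ ⟧ * f (s ⊞ content κ)))
        ≡⟨ ∑-*ˡ cols ⟦ e ==ᵇ c ⟧ (λ κ → ⟦ cycleThrough c κ ⟧ * f (s ⊞ content κ)) ⟩
      ⟦ e ==ᵇ c ⟧ * cycles c s
        ≡⟨ cong (λ b → ⟦ b ⟧ * cycles c s) (==ᵇ-sym e c) ⟩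
      ⟦ c ==ᵇ e ⟧ * cycles c s ∎

  χ⊗-tailed : ∀ A k (f : Weight N) → χ⊗ A (tailed H k) f ≡ tailSum k (attach (λ _ → proper A) f)
  χ⊗-tailed A k f =
    trans (∑-cong cols (λ κ → trans (cong (⟦ proper A κ ⟧ *_) (χ-tailed k (λ t → f (content κ ⊞ t))))
                                    (tailSum-*ˡ k ⟦ proper A κ ⟧ (λ _ s → f (content κ ⊞ s)))))
   (trans (tailSum-∑ k cols (λ κ _ s → ⟦ proper A κ ⟧ * f (content κ ⊞ s)))
          (tailSum-cong k (λ _ s → ∑-cong cols (λ κ → cong (λ t → ⟦ proper A κ ⟧ * f t) (⊞-comm (content κ) s)))))
    where cols = allVec N (∣V∣ A)

  χ-tailed-++ : ∀ k q (f : Weight N) → χ (tailed H (k + q)) f ≡ tailSum k (attach {q = q} pathFrom f)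
  χ-tailed-++ k q f = trans (χ-tailed (k + q) f) (tailSum-++ k q (λ _ s → f s))

  χ-P-K₂ : ∀ k (f : Weight N) → χ (P k (C 2) H) f ≡ χ (tailed H (k + 1)) f
  χ-P-K₂ k f = trans (χ-P 0 k f) (sym (trans (χ-tailed-++ k 1 f)
    (tailSum-cong k (λ c s → attach-cong {q = 1} pathFrom cycleThrough f c s (λ { (a ∷ []) → sym (properCycle-K₂ c a) })))))

  χ-P-suc : ∀ j k (f : Weight N) → χ (P (suc k) (C (2 + j)) H) f ≡ tailSum k (attach {q = 2 + j} cycleBeyond f)
  χ-P-suc j k f = begin
    χ (P (suc k) (C (2 + j)) H) f
      ≡⟨ χ-P j (suc k) f ⟩
    tailSum (suc k) (attach {q = suc j} cycleThrough f)
      ≡⟨ tailSum-suc k (attach {q = suc j} cycleThrough f) ⟩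
    tailSum k (λ c s → ∑[ z ∈ allFin N ] (⟦ c ≠ᵇ z ⟧ * attach {q = suc j} cycleThrough f z (s ⊞ δ z)))
      ≡⟨ tailSum-cong k (λ c s → trans (attach-∷ cycleThrough f c s)
           (attach-cong (λ c κ → c ≠ᵇ head κ ∧ cycleThrough (head κ) (tail κ)) cycleBeyond f c s
                        (λ { (x ∷ κ) → refl }))) ⟩
    tailSum k (attach cycleBeyond f) ∎

  cycle-recurrence : ∀ j k (f : Weight N) →
      χ (P k (C (3 + j)) H) f + χ⊗ (C (2 + j)) (tailed H k) f
    ≡ χ (P (suc k) (C (2 + j)) H) f + χ (tailed H (k + (2 + j))) f
  cycle-recurrence j k f = begin
    χ (P k (C (3 + j)) H) f + χ⊗ (C (2 + j)) (tailed H k) f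
      ≡⟨ cong₂ _+_ (χ-P (suc j) k f) (χ⊗-tailed (C (2 + j)) k f) ⟩
    tailSum k (attachᵍ cycleThrough f) + tailSum k (attachᵍ (λ _ → proper (cyc j)) f)
      ≡⟨ tailSum-+ k (attachᵍ cycleThrough f) (attachᵍ (λ _ → proper (cyc j)) f) ⟩
    tailSum k (λ c s → attachᵍ cycleThrough f c s + attachᵍ (λ _ → proper (cyc j)) f c s)
      ≡⟨ tailSum-cong k (λ c s →
           trans (cong (_+_ (attachᵍ cycleThrough f c s)) (attach-cong _ cycleApart f c s (proper-cyc j)))
                 (cycle-exchange f c s)) ⟩
    tailSum k (λ c s → attachᵍ cycleBeyond f c s + attachᵍ pathFrom f c s)
      ≡⟨ tailSum-+ k (attachᵍ cycleBeyond f) (attachᵍ pathFrom f) ⟨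
    tailSum k (attachᵍ cycleBeyond f) + tailSum k (attachᵍ pathFrom f)
      ≡⟨ cong₂ _+_ (χ-P-suc j k f) (χ-tailed-++ k (2 + j) f) ⟨
    χ (P (suc k) (C (2 + j)) H) f + χ (tailed H (k + (2 + j))) f ∎
    where
    attachᵍ : (Fin N → Vec (Fin N) (2 + j) → Bool) → Weight N → Attachment N
    attachᵍ = attach

sumℤ-range-suc : ∀ n (F : ℕ → ℤ) → sumℤ (map F (range 1 (suc n))) ≡ F 1 +ℤ sumℤ (map (F ∘ ℕ.suc) (range 1 n))
sumℤ-range-suc n F = cong (λ xs → F 1 +ℤ sumℤ xs) (begin
  map F (map ℕ.suc (applyUpTo ℕ.suc n))   ≡⟨ cong (map F) (map-applyUpTo ℕ.suc ℕ.suc n) ⟩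
  map F (applyUpTo (ℕ.suc ∘ ℕ.suc) n)     ≡⟨ map-applyUpTo (ℕ.suc ∘ ℕ.suc) F n ⟩
  applyUpTo (F ∘ ℕ.suc ∘ ℕ.suc) n         ≡⟨ map-applyUpTo ℕ.suc (F ∘ ℕ.suc) n ⟨
  map (F ∘ ℕ.suc) (applyUpTo ℕ.suc n)     ≡⟨ cong (map (F ∘ ℕ.suc)) (map-applyUpTo (λ i → i) ℕ.suc n) ⟨
  map (F ∘ ℕ.suc) (map ℕ.suc (upTo n))    ∎)

module _ (H : RGraph) {N : ℕ} (α : Fin N → ℕ) where
  open TailSums {N} H using (χ-P-K₂; cycle-recurrence)

  X-cycle-recurrence : ∀ j k →
      X (P k (C (3 + j)) H) N α +ℤ (X (C (2 + j)) N ⊗ X (tailed H k) N) α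
    ≡ X (P (suc k) (C (2 + j)) H) N α +ℤ X (tailed H (k + (2 + j))) N α
  X-cycle-recurrence j k = begin
    X (P k (C (3 + j)) H) N α +ℤ (X (C (2 + j)) N ⊗ X (tailed H k) N) α
      ≡⟨ cong₂ _+ℤ_ (X≡χ (P k (C (3 + j)) H) α) (⊗≡χ⊗ (C (2 + j)) (tailed H k) α) ⟩
    + χ (P k (C (3 + j)) H) f +ℤ + χ⊗ (C (2 + j)) (tailed H k) f
      ≡⟨ ℤ.pos-+ (χ (P k (C (3 + j)) H) f) _ ⟨
    + (χ (P k (C (3 + j)) H) f + χ⊗ (C (2 + j)) (tailed H k) f)
      ≡⟨ cong +_ (cycle-recurrence j k f) ⟩
    + (χ (P (suc k) (C (2 + j)) H) f + χ (tailed H (k + (2 + j))) f)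
      ≡⟨ ℤ.pos-+ (χ (P (suc k) (C (2 + j)) H) f) _ ⟩
    + χ (P (suc k) (C (2 + j)) H) f +ℤ + χ (tailed H (k + (2 + j))) f
      ≡⟨ cong₂ _+ℤ_ (X≡χ (P (suc k) (C (2 + j)) H) α) (X≡χ (tailed H (k + (2 + j))) α) ⟨
    X (P (suc k) (C (2 + j)) H) N α +ℤ X (tailed H (k + (2 + j))) N α ∎
    where
    f = coeff α

  cycle-formula : ∀ j k → X (P k (C (2 + j)) H) N α
      ≡ (((+ (2 + j ∸ 1)) · X (tailed H (k + (2 + j) ∸ 1)) N)
          ⊖ (Σ[ range 1 (2 + j ∸ 2) ] (λ l → X (C (2 + j ∸ l)) N ⊗ X (tailed H (k + l ∸ 1)) N))) α
  cycle-formula zero    k = begin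
    X (P k (C 2) H) N α               ≡⟨ X≡χ (P k (C 2) H) α ⟩
    + χ (P k (C 2) H) (coeff α)       ≡⟨ cong +_ (χ-P-K₂ k (coeff α)) ⟩
    + χ (tailed H (k + 1)) (coeff α)  ≡⟨ X≡χ (tailed H (k + 1)) α ⟨
    T (k + 1)                         ≡⟨ cong (T ∘ (_∸ 1)) (+-suc k 1) ⟨
    T (k + 2 ∸ 1)                     ≡⟨ unit (T (k + 2 ∸ 1)) ⟩
    + 1 *ℤ T (k + 2 ∸ 1) -ℤ + 0       ∎
    where
    T : ℕ → ℤ
    T L = X (tailed H L) N α
    unit : ∀ x → x ≡ + 1 *ℤ x -ℤ + 0
    unit = solve-∀
  cycle-formula (suc j) k = begin
    x                                    ≡⟨ add-sub x p ⟩
    x +ℤ p -ℤ p                          ≡⟨ cong (_-ℤ p) (X-cycle-recurrence j k) ⟩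
    X (P (suc k) (C (2 + j)) H) N α +ℤ t -ℤ p
                                         ≡⟨ cong (λ y → y +ℤ t -ℤ p) (cycle-formula j (suc k)) ⟩
    + (1 + j) *ℤ t -ℤ S +ℤ t -ℤ p        ≡⟨ regroup (+ (1 + j)) t S p ⟩
    + (2 + j) *ℤ t -ℤ (p +ℤ S)           ≡⟨ cong₂ (λ L y → + (2 + j) *ℤ T L -ℤ y) (cong (_∸ 1) (+-suc k (2 + j))) sum-peel ⟨
    + (2 + j) *ℤ T (k + (3 + j) ∸ 1) -ℤ sumℤ (map Π (range 1 (1 + j))) ∎
    where
    T : ℕ → ℤ
    T L = X (tailed H L) N α
    Π : ℕ → ℤ
    Π l = (X (C (3 + j ∸ l)) N ⊗ X (tailed H (k + l ∸ 1)) N) α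
    x = X (P k (C (3 + j)) H) N α
    p = (X (C (2 + j)) N ⊗ X (tailed H k) N) α
    t = T (k + (2 + j))
    S = sumℤ (map (λ l → (X (C (2 + j ∸ l)) N ⊗ X (tailed H (suc k + l ∸ 1)) N) α) (range 1 j))
    add-sub : ∀ x p → x ≡ x +ℤ p -ℤ p
    add-sub = solve-∀
    regroup : ∀ a t S p → a *ℤ t -ℤ S +ℤ t -ℤ p ≡ (+ 1 +ℤ a) *ℤ t -ℤ (p +ℤ S)
    regroup = solve-∀
    sum-peel : sumℤ (map Π (range 1 (1 + j))) ≡ p +ℤ S
    sum-peel = trans (sumℤ-range-suc j Π) (cong₂ _+ℤ_
      (cong (λ L → (X (C (2 + j)) N ⊗ X (tailed H L) N) α) (m+n∸n≡m k 1))
      (cong sumℤ (map-cong (λ l → cong (λ L → (X (C (2 + j ∸ l)) N ⊗ X (tailed H (L ∸ 1)) N) α) (+-suc k l)) (range 1 j))))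

proposition3p2 : (H : RGraph) → Loopless H → (k g : ℕ) → 2 ≤ g →
    (N : ℕ) → (α : Fin N → ℕ) →
    X (P k (C g) H) N α
      ≡ (((+ (g ∸ 1)) · X (tailed H (k + g ∸ 1)) N)
          ⊖ (Σ[ range 1 (g ∸ 2) ] (λ l → X (C (g ∸ l)) N ⊗ X (tailed H (k + l ∸ 1)) N))) α
proposition3p2 H _ k (suc (suc j)) (s≤s (s≤s z≤n)) N α = cycle-formula H α j k
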